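{- For every composition $\alpha$: (a) $\mathcal B(1,0)_\alpha=H_{\alpha^c}$; (b) $\mathcal B(-1,1)_\alpha=\Lambda_{\alpha^c}$; (c) $\mathcal B(1,-1)_\alpha=E^*_{\alpha^c}$.
   Context: Compositions of $n$ correspond bijectively to subsets of $[n-1]=\{1,\dots,n-1\}$ via $\mathrm{set}(\alpha_1,\dots,\alpha_l)=\{\alpha_1,\alpha_1+\alpha_2,\dots,\alpha_1+\dots+\alpha_{l-1}\}$ and its inverse $\mathrm{comp}$. For $\alpha$ a composition of $n$, $\alpha^c=\mathrm{comp}([n-1]\setminus\mathrm{set}(\alpha))$. For compositions $\alpha,\beta$ of $n$, $\beta\preceq\alpha$ means $\mathrm{set}(\alpha)\subseteq\mathrm{set}(\beta)$; $\ell(\alpha)$ is the number of parts. $\mathsf{NSym}$ is the Hopf algebra of noncommutative symmetric functions (graded dual of $\mathsf{QSym}$), the free associative algebra on $H_1,H_2,\dots$; $H_\alpha=H_{\alpha_1}\cdots H_{\alpha_l}$ is the basis dual to the monomial quasisymmetric functions $M_\alpha$. $\Lambda_\alpha=\sum_{\beta\preceq\alpha}(-1)^{n-\ell(\beta)}H_\beta$ and $E^*_\alpha=\sum_{\beta\preceq\alpha}(-1)^{\ell(\beta)-\ell(\alpha)}H_\beta$. Over the rational function field $\mathbb C(q,t)$, for $I\subseteq[n-1]$, $\mathcal B(q,t)_{\mathrm{comp}(I)}=\sum_{J\subseteq[n-1]:\,I\cup J=[n-1]}q^{|I\setminus J|}t^{|I\cap J|}H_{\mathrm{comp}(J)}$;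 $\mathcal B(a,b)_\alpha$ denotes its specialization at $q=a,t=b$ (with $0^0=1$). -}

module Defs where

open import Data.Nat using (ℕ; suc; _∸_)
open import Data.Integer using (ℤ; +_; -_; _*_; _^_)
open import Data.Bool using (_≟_)
open import Data.Fin.Subset using (Subset; ⊤; ∁; _∪_; _∩_; _─_; ∣_∣; _⊆_)
open import Data.Fin.Subset.Properties using (_⊆?_)
open import Data.Vec.Properties using (≡-dec)
open import Relation.Binary.PropositionalEquality using (_≡_)
open import Relation.Nullary using (Dec; yes; no)

-- Conventions.  A composition of n = suc m is identified with its set
-- set(α) ⊆ [n-1] = [m], represented as a Subset m (Fin m ≅ {1,…,m}).
-- 'comp I' is thus represented by I itself.
Comp : ℕ → Set
Comp m = Subset m

_ᶜ : ∀ {m} → Comp m → Comp m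
α ᶜ = ∁ α

ℓ : ∀ {m} → Comp m → ℕ
ℓ J = suc ∣ J ∣

_⪯_ : ∀ {m} → Comp m → Comp m → Set
β ⪯ α = α ⊆ β

_⪯?_ : ∀ {m} (β α : Comp m) → Dec (β ⪯ α)
β ⪯? α = α ⊆? β

-- The degree-n component of NSym (n = suc m), over ℤ, written in the
-- H-basis: an element is its coefficient function β ↦ [H_β] f.
-- (The H_β, β ⊨ n, form a basis of NSym_n, so this is faithful.)
NSymₙ : ℕ → Set
NSymₙ m = Comp m → ℤ

_≋_ : ∀ {m} → NSymₙ m → NSymₙ m → Set
f ≋ g = ∀ β → f β ≡ g β

H : ∀ {m} → Comp m → NSymₙ m
H α β with ≡-dec _≟_ β α
... | yes _ = + 1
... | no  _ = + 0

Λ : ∀ {m} → Comp m → NSymₙ m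
Λ {m} α β with β ⪯? α
... | yes _ = (- + 1) ^ (suc m ∸ ℓ β)
... | no  _ = + 0

E* : ∀ {m} → Comp m → NSymₙ m
E* α β with β ⪯? α
... | yes _ = (- + 1) ^ (ℓ β ∸ ℓ α)
... | no  _ = + 0

-- Specialization B(a,b)_{comp I} =
--   Σ_{J : I ∪ J = [n-1]} a^{|I \ J|} b^{|I ∩ J|} H_{comp J}
-- (ℤ's _^_ has x ^ 0 = 1, matching the convention 0^0 = 1.)
B : ℤ → ℤ → ∀ {m} → Comp m → NSymₙ m
B a b I J with ≡-dec _≟_ (I ∪ J) ⊤
... | yes _ = (a ^ ∣ I ─ J ∣) * (b ^ ∣ I ∩ J ∣)
... | no  _ = + 0

{-# OPTIONS --safe #-}
-- The coefficient of H_J in B(a,b)_{comp I} is nonzero only when I ∪ J = [n-1],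
-- i.e. when ∁ I ⊆ J, which says exactly that comp J ⪯ α^c for α = comp I.
-- On that range the two exponents are read off from J alone:
-- |I \ J| = (n-1) - |J| = n - ℓ(J) and |I ∩ J| = |J| - |∁ I| = ℓ(J) - ℓ(α^c).
-- So B(-1,1) and B(1,-1) produce the signs of Λ_{α^c} and E*_{α^c}, while in
-- B(1,0) the factor 0^{ℓ(J) - ℓ(α^c)} keeps only the term J = ∁ I.
module Submission where

open import Defs
open import Data.Nat using (ℕ; suc; _∸_; _+_; _<_)
open import Data.Nat.Properties using (+-suc; m+n∸m≡n; n∸n≡0; m<n⇒0<n∸m)
open import Data.Integer using (0ℤ; 1ℤ; -1ℤ; +_; -_; _*_; _^_)
open import Data.Integer.Properties using (*-identityˡ; *-identityʳ; ^-zeroˡ)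
open import Data.Product using (_×_; _,_)
open import Data.Bool using (_≟_)
open import Data.Vec using ([]; _∷_)
open import Data.Vec.Properties using (≡-dec)
open import Data.Fin.Subset
  using (Subset; ⊤; ∁; _∪_; _∩_; _─_; ∣_∣; _⊆_; _⊂_; _∈_; inside; outside)
open import Data.Fin.Subset.Properties
  using (_∈?_; ⊆-reflexive; ⊆-antisym; ⊆⊤; ∈⊤; drop-∷-⊆; p⊆p∪q; q⊆p∪q; x∈p∪q⁻;
         x∉p⇒x∈∁p; x∈∁p⇒x∉p; ∣⊤∣≡n; s⊂s; out⊂in; p⊂q⇒∣p∣<∣q∣)
open import Data.Sum using (inj₁; inj₂)
open import Data.Empty using (⊥-elim)
open import Data.Vec.Base using (here)
open import Function using (_∘_)
open import Relation.Binary.PropositionalEquality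
  using (_≡_; _≢_; refl; sym; trans; cong; subst; module ≡-Reasoning)
open import Relation.Nullary using (yes; no; ¬_; contradiction)

private
  variable
    n : ℕ
    p q : Subset n

p∪q≡⊤⇒∁p⊆q : p ∪ q ≡ ⊤ → ∁ p ⊆ q
p∪q≡⊤⇒∁p⊆q {p = p} {q} p∪q≡⊤ x∈∁p with x∈p∪q⁻ p q (subst (_ ∈_) (sym p∪q≡⊤) ∈⊤)
... | inj₁ x∈p = contradiction x∈p (x∈∁p⇒x∉p x∈∁p)
... | inj₂ x∈q = x∈q

∁p⊆q⇒p∪q≡⊤ : ∁ p ⊆ q → p ∪ q ≡ ⊤
∁p⊆q⇒p∪q≡⊤ {p = p} {q} ∁p⊆q = ⊆-antisym ⊆⊤ ⊤⊆p∪q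
  where
  ⊤⊆p∪q : ⊤ ⊆ p ∪ q
  ⊤⊆p∪q {x} _ with x ∈? p
  ... | yes x∈p = p⊆p∪q q x∈p
  ... | no  x∉p = q⊆p∪q p q (∁p⊆q (x∉p⇒x∈∁p x∉p))

∁p⊆q⇒q─p≡∁p : ∁ p ⊆ q → q ─ p ≡ ∁ p
∁p⊆q⇒q─p≡∁p {p = []}          {[]}          _   = refl
∁p⊆q⇒q─p≡∁p {p = inside  ∷ p} {_ ∷ q}       ∁p⊆q = cong (outside ∷_) (∁p⊆q⇒q─p≡∁p (drop-∷-⊆ ∁p⊆q))
∁p⊆q⇒q─p≡∁p {p = outside ∷ p} {inside ∷ q}  ∁p⊆q = cong (inside ∷_) (∁p⊆q⇒q─p≡∁p (drop-∷-⊆ ∁p⊆q))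
∁p⊆q⇒q─p≡∁p {p = outside ∷ p} {outside ∷ q} ∁p⊆q with ∁p⊆q here
... | ()

p⊆q∧p≢q⇒p⊂q : p ⊆ q → p ≢ q → p ⊂ q
p⊆q∧p≢q⇒p⊂q {p = []}          {[]}          _   p≢q = contradiction refl p≢q
p⊆q∧p≢q⇒p⊂q {p = inside  ∷ p} {inside  ∷ q} p⊆q p≢q =
  s⊂s (p⊆q∧p≢q⇒p⊂q (drop-∷-⊆ p⊆q) (p≢q ∘ cong (inside ∷_)))
p⊆q∧p≢q⇒p⊂q {p = outside ∷ p} {outside ∷ q} p⊆q p≢q =
  s⊂s (p⊆q∧p≢q⇒p⊂q (drop-∷-⊆ p⊆q) (p≢q ∘ cong (outside ∷_)))
p⊆q∧p≢q⇒p⊂q {p = outside ∷ p} {inside  ∷ q} p⊆q _ = out⊂in (drop-∷-⊆ p⊆q)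
p⊆q∧p≢q⇒p⊂q {p = inside  ∷ p} {outside ∷ q} p⊆q _ with p⊆q here
... | ()

∣q∣+∣p─q∣≡∣p∪q∣ : ∀ (p q : Subset n) → ∣ q ∣ + ∣ p ─ q ∣ ≡ ∣ p ∪ q ∣
∣q∣+∣p─q∣≡∣p∪q∣ []            []            = refl
∣q∣+∣p─q∣≡∣p∪q∣ (inside  ∷ p) (inside  ∷ q) = cong suc (∣q∣+∣p─q∣≡∣p∪q∣ p q)
∣q∣+∣p─q∣≡∣p∪q∣ (outside ∷ p) (inside  ∷ q) = cong suc (∣q∣+∣p─q∣≡∣p∪q∣ p q)
∣q∣+∣p─q∣≡∣p∪q∣ (outside ∷ p) (outside ∷ q) = ∣q∣+∣p─q∣≡∣p∪q∣ p q
∣q∣+∣p─q∣≡∣p∪q∣ (inside  ∷ p) (outside ∷ q) =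
  trans (+-suc ∣ q ∣ ∣ p ─ q ∣) (cong suc (∣q∣+∣p─q∣≡∣p∪q∣ p q))

∣q─p∣+∣p∩q∣≡∣q∣ : ∀ (p q : Subset n) → ∣ q ─ p ∣ + ∣ p ∩ q ∣ ≡ ∣ q ∣
∣q─p∣+∣p∩q∣≡∣q∣ []            []            = refl
∣q─p∣+∣p∩q∣≡∣q∣ (inside  ∷ p) (inside  ∷ q) =
  trans (+-suc ∣ q ─ p ∣ ∣ p ∩ q ∣) (cong suc (∣q─p∣+∣p∩q∣≡∣q∣ p q))
∣q─p∣+∣p∩q∣≡∣q∣ (outside ∷ p) (inside  ∷ q) = cong suc (∣q─p∣+∣p∩q∣≡∣q∣ p q)
∣q─p∣+∣p∩q∣≡∣q∣ (inside  ∷ p) (outside ∷ q) = ∣q─p∣+∣p∩q∣≡∣q∣ p q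
∣q─p∣+∣p∩q∣≡∣q∣ (outside ∷ p) (outside ∷ q) = ∣q─p∣+∣p∩q∣≡∣q∣ p q

p∪q≡⊤⇒∣p─q∣≡n∸∣q∣ : ∀ {n} {p q : Subset n} → p ∪ q ≡ ⊤ → ∣ p ─ q ∣ ≡ n ∸ ∣ q ∣
p∪q≡⊤⇒∣p─q∣≡n∸∣q∣ {n} {p} {q} p∪q≡⊤ = begin
  ∣ p ─ q ∣                  ≡⟨ m+n∸m≡n ∣ q ∣ ∣ p ─ q ∣ ⟨
  ∣ q ∣ + ∣ p ─ q ∣ ∸ ∣ q ∣  ≡⟨ cong (_∸ ∣ q ∣) (∣q∣+∣p─q∣≡∣p∪q∣ p q) ⟩
  ∣ p ∪ q ∣ ∸ ∣ q ∣          ≡⟨ cong (λ r → ∣ r ∣ ∸ ∣ q ∣) p∪q≡⊤ ⟩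
  ∣ ⊤ {n} ∣ ∸ ∣ q ∣          ≡⟨ cong (_∸ ∣ q ∣) (∣⊤∣≡n n) ⟩
  n ∸ ∣ q ∣                  ∎
  where open ≡-Reasoning

∁p⊆q⇒∣p∩q∣≡∣q∣∸∣∁p∣ : ∁ p ⊆ q → ∣ p ∩ q ∣ ≡ ∣ q ∣ ∸ ∣ ∁ p ∣
∁p⊆q⇒∣p∩q∣≡∣q∣∸∣∁p∣ {p = p} {q} ∁p⊆q = begin
  ∣ p ∩ q ∣                          ≡⟨ m+n∸m≡n ∣ q ─ p ∣ ∣ p ∩ q ∣ ⟨
  ∣ q ─ p ∣ + ∣ p ∩ q ∣ ∸ ∣ q ─ p ∣  ≡⟨ cong (_∸ ∣ q ─ p ∣) (∣q─p∣+∣p∩q∣≡∣q∣ p q) ⟩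
  ∣ q ∣ ∸ ∣ q ─ p ∣                  ≡⟨ cong (λ r → ∣ q ∣ ∸ ∣ r ∣) (∁p⊆q⇒q─p≡∁p ∁p⊆q) ⟩
  ∣ q ∣ ∸ ∣ ∁ p ∣                    ∎
  where open ≡-Reasoning

0ℤ^-positive : ∀ {k} → 0 < k → 0ℤ ^ k ≡ 0ℤ
0ℤ^-positive {suc k} _ = refl

H-⊆ : p ⊆ q → H p q ≡ 0ℤ ^ (∣ q ∣ ∸ ∣ p ∣)
H-⊆ {p = p} {q} p⊆q with ≡-dec _≟_ q p
... | yes refl = cong (0ℤ ^_) (sym (n∸n≡0 ∣ q ∣))
... | no  q≢p  = sym (0ℤ^-positive (m<n⇒0<n∸m (p⊂q⇒∣p∣<∣q∣ p⊂q)))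
  where p⊂q = p⊆q∧p≢q⇒p⊂q p⊆q (q≢p ∘ sym)

H-⊈ : ¬ p ⊆ q → H p q ≡ 0ℤ
H-⊈ {p = p} {q} p⊈q with ≡-dec _≟_ q p
... | yes refl = ⊥-elim (p⊈q (⊆-reflexive refl))
... | no  _    = refl

B-⊆ : ∀ a b → ∁ p ⊆ q → B a b p q ≡ a ^ ∣ p ─ q ∣ * b ^ ∣ p ∩ q ∣
B-⊆ {p = p} {q} a b ∁p⊆q with ≡-dec _≟_ (p ∪ q) ⊤
... | yes _      = refl
... | no  p∪q≢⊤  = contradiction (∁p⊆q⇒p∪q≡⊤ ∁p⊆q) p∪q≢⊤

B-⊈ : ∀ a b → ¬ ∁ p ⊆ q → B a b p q ≡ 0ℤ
B-⊈ {p = p} {q} a b ∁p⊈q with ≡-dec _≟_ (p ∪ q) ⊤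
... | yes p∪q≡⊤ = ⊥-elim (∁p⊈q (p∪q≡⊤⇒∁p⊆q p∪q≡⊤))
... | no  _     = refl

B[1,0]α≋Hαᶜ : ∀ {m} (α : Comp m) → B (+ 1) (+ 0) α ≋ H (α ᶜ)
B[1,0]α≋Hαᶜ α β with β ⪯? (α ᶜ)
... | no  ∁α⊈β = trans (B-⊈ 1ℤ 0ℤ ∁α⊈β) (sym (H-⊈ ∁α⊈β))
... | yes ∁α⊆β = begin
  B 1ℤ 0ℤ α β                         ≡⟨ B-⊆ 1ℤ 0ℤ ∁α⊆β ⟩
  1ℤ ^ ∣ α ─ β ∣ * 0ℤ ^ ∣ α ∩ β ∣     ≡⟨ cong (_* 0ℤ ^ ∣ α ∩ β ∣) (^-zeroˡ ∣ α ─ β ∣) ⟩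
  1ℤ * 0ℤ ^ ∣ α ∩ β ∣                 ≡⟨ *-identityˡ _ ⟩
  0ℤ ^ ∣ α ∩ β ∣                      ≡⟨ cong (0ℤ ^_) (∁p⊆q⇒∣p∩q∣≡∣q∣∸∣∁p∣ ∁α⊆β) ⟩
  0ℤ ^ (∣ β ∣ ∸ ∣ ∁ α ∣)              ≡⟨ H-⊆ ∁α⊆β ⟨
  H (α ᶜ) β                           ∎
  where open ≡-Reasoning

-- Λ and E* branch on the same test β ⪯? α ᶜ, so the `with` evaluates them too.
B[-1,1]α≋Λαᶜ : ∀ {m} (α : Comp m) → B (- + 1) (+ 1) α ≋ Λ (α ᶜ)
B[-1,1]α≋Λαᶜ {m} α β with β ⪯? (α ᶜ)
... | no  ∁α⊈β = B-⊈ -1ℤ 1ℤ ∁α⊈β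
... | yes ∁α⊆β = begin
  B -1ℤ 1ℤ α β                        ≡⟨ B-⊆ -1ℤ 1ℤ ∁α⊆β ⟩
  -1ℤ ^ ∣ α ─ β ∣ * 1ℤ ^ ∣ α ∩ β ∣    ≡⟨ cong (-1ℤ ^ ∣ α ─ β ∣ *_) (^-zeroˡ ∣ α ∩ β ∣) ⟩
  -1ℤ ^ ∣ α ─ β ∣ * 1ℤ                ≡⟨ *-identityʳ _ ⟩
  -1ℤ ^ ∣ α ─ β ∣                     ≡⟨ cong (-1ℤ ^_) (p∪q≡⊤⇒∣p─q∣≡n∸∣q∣ (∁p⊆q⇒p∪q≡⊤ ∁α⊆β)) ⟩
  -1ℤ ^ (m ∸ ∣ β ∣)                   ∎
  where open ≡-Reasoning

B[1,-1]α≋E*αᶜ : ∀ {m} (α : Comp m) → B (+ 1) (- + 1) α ≋ E* (α ᶜ)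
B[1,-1]α≋E*αᶜ α β with β ⪯? (α ᶜ)
... | no  ∁α⊈β = B-⊈ 1ℤ -1ℤ ∁α⊈β
... | yes ∁α⊆β = begin
  B 1ℤ -1ℤ α β                        ≡⟨ B-⊆ 1ℤ -1ℤ ∁α⊆β ⟩
  1ℤ ^ ∣ α ─ β ∣ * -1ℤ ^ ∣ α ∩ β ∣    ≡⟨ cong (_* -1ℤ ^ ∣ α ∩ β ∣) (^-zeroˡ ∣ α ─ β ∣) ⟩
  1ℤ * -1ℤ ^ ∣ α ∩ β ∣                ≡⟨ *-identityˡ _ ⟩
  -1ℤ ^ ∣ α ∩ β ∣                     ≡⟨ cong (-1ℤ ^_) (∁p⊆q⇒∣p∩q∣≡∣q∣∸∣∁p∣ ∁α⊆β) ⟩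
  -1ℤ ^ (∣ β ∣ ∸ ∣ ∁ α ∣)             ∎
  where open ≡-Reasoning

proposition4p2 : ∀ (m : ℕ) (α : Comp m) →
    (B (+ 1) (+ 0) α ≋ H (α ᶜ))
    × (B (- + 1) (+ 1) α ≋ Λ (α ᶜ))
    × (B (+ 1) (- + 1) α ≋ E* (α ᶜ))
proposition4p2 m α = B[1,0]α≋Hαᶜ α , B[-1,1]α≋Λαᶜ α , B[1,-1]α≋E*αᶜ α
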